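{- Let $q$ be a prime, $F=\mathbb{Z}/q\mathbb{Z}$, and let $A$ be a subset of $F$ with $|A|>|F|^{1/2}$. Then $$|I(A)|\ge|F|/2.$$
   Context: For $A\subset F$, $$I(A):=\{a_1(a_2-a_3)+a_4(a_5-a_6):a_1,\dots,a_6\in A\}.$$ -}

module Defs where

open import Data.Nat using (ℕ; _+_; _*_; _∸_; NonZero)
open import Data.Nat.DivMod using (_mod_)
open import Data.Fin using (Fin; toℕ)
open import Data.Fin.Properties using (any?)
open import Data.Fin.Subset using (Subset; _∈_)
open import Data.Fin.Subset.Properties using (_∈?_)
open import Data.Vec using (tabulate)
open import Data.Product using (∃; _×_; _,_)
open import Relation.Nullary using (Dec; yes; no)
open import Relation.Nullary.Decidable using (⌊_⌋; _×-dec_)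
open import Relation.Binary.PropositionalEquality using (_≡_)
open import Data.Fin.Properties using (_≟_)

module ZMod (q : ℕ) .{{_ : NonZero q}} where

  F : Set
  F = Fin q

  _⊕_ : F → F → F
  a ⊕ b = (toℕ a + toℕ b) mod q

  _⊗_ : F → F → F
  a ⊗ b = (toℕ a * toℕ b) mod q

  _⊖_ : F → F → F
  a ⊖ b = (toℕ a + (q ∸ toℕ b)) mod q

  infixl 6 _⊕_ _⊖_
  infixl 7 _⊗_

  InI : Subset q → F → Set
  InI A x = ∃ λ a₁ → ∃ λ a₂ → ∃ λ a₃ → ∃ λ a₄ → ∃ λ a₅ → ∃ λ a₆ →
    (a₁ ∈ A × a₂ ∈ A × a₃ ∈ A × a₄ ∈ A × a₅ ∈ A × a₆ ∈ A) ×
    x ≡ a₁ ⊗ (a₂ ⊖ a₃) ⊕ a₄ ⊗ (a₅ ⊖ a₆)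

  InI? : (A : Subset q) (x : F) → Dec (InI A x)
  InI? A x =
    any? λ a₁ → any? λ a₂ → any? λ a₃ → any? λ a₄ → any? λ a₅ → any? λ a₆ →
      ((a₁ ∈? A) ×-dec ((a₂ ∈? A) ×-dec ((a₃ ∈? A) ×-dec ((a₄ ∈? A) ×-dec
        ((a₅ ∈? A) ×-dec (a₆ ∈? A))))))
      ×-dec (x ≟ (a₁ ⊗ (a₂ ⊖ a₃) ⊕ a₄ ⊗ (a₅ ⊖ a₆)))

  I : Subset q → Subset q
  I A = tabulate λ x → ⌊ InI? A x ⌋

module Submission where

-- Fix k with (k - 1)² < q < k² and k ≤ |A|, and a k-element list L ⊆ A.  Call two points of
-- L × L aligned for a slope ξ when they differ in both coordinates and a + ξb = c + ξd.  Such
-- a pair of points is aligned for at most one slope, so averaging over the q - 1 nonzero slopes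
-- gives a ξ ≠ 0 with at most k²(k - 1)²/(q - 1) ≤ k² aligned pairs.  As k² > q, the map
-- (a, b) ↦ a + ξb collides on L × L, say at (a, b) ≠ (c, d); then b ≠ d and c - a = ξ(b - d).
-- The map (a₁, a₄) ↦ a₁(b - d) + a₄(c - a) takes values in I(A) and equals
-- (b - d)(a₁ + ξa₄), so its collisions are aligned pairs.  A map on k² points with at most k²
-- ordered collisions has an image of size at least k²/2, whence 2|I(A)| ≥ k² > q.

open import Defs
open import Data.Bool using (true; false)
open import Data.Fin using (Fin; zero; suc; toℕ)
import Data.Fin.Properties as Fin
open import Data.Fin.Properties using (toℕ-fromℕ<; toℕ-injective; toℕ<n)
open import Data.Fin.Subset using (Subset; ∣_∣) renaming (_∈_ to _∈ₛ_)
open import Data.List using (List; []; _∷_; length; map; _++_; cartesianProduct; take; allFin)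
open import Data.List.Membership.Propositional using (_∈_)
open import Data.List.Membership.Propositional.Properties using (∈-map⁺; ∈-map⁻; ∈-allFin; ∈-cartesianProduct⁻)
open import Data.List.Properties using (length-++; length-map; length-take; length-removeAt′; length-tabulate)
import Data.List.Relation.Binary.Sublist.Propositional as Sublist
import Data.List.Relation.Binary.Sublist.Propositional.Properties as Sublist
import Data.List.Relation.Unary.All as All
open import Data.List.Relation.Unary.AllPairs using ([]; _∷_)
open import Data.List.Relation.Unary.Any using (here; there; index; _─_)
open import Data.List.Relation.Unary.Unique.Propositional using (Unique)
import Data.List.Relation.Unary.Unique.Propositional.Properties as Unique
open import Data.Nat using (ℕ; zero; suc; _+_; _*_; _∸_; _≤_; _<_; _%_; NonZero; z≤n; s≤s; z<s; _≤?_; _<?_;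
  >-nonZero; >-nonZero⁻¹; nonTrivial⇒n>1)
open import Data.Nat.DivMod using (_mod_; m%n%n≡m%n; %-distribˡ-+; %-distribˡ-*; m*n%n≡0; n%n≡0; m<n⇒m%n≡m; m%n<n)
open import Data.Nat.Divisibility using (_∣_; divides; m%n≡0⇒n∣m; n∣m⇒m%n≡0)
open import Data.Nat.Primality
  using (Prime; prime⇒nonZero; prime⇒nonTrivial; euclidsLemma; ¬prime[0]; ¬prime[1]; prime⇒¬composite; composite)
open import Data.Nat.Properties
open import Data.Nat.Tactic.RingSolver using (solve-∀)
open import Data.Product using (∃; _×_; _,_; proj₁; proj₂)
import Data.Product.Properties as ×
open import Data.Sum using (inj₁; inj₂)
open import Data.Vec using ([]; _∷_; here; there; lookup)
open import Data.Vec.Properties using (lookup⇒[]=; lookup∘tabulate)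
open import Function using (_∘_; id)
open import Level using (0ℓ)
open import Relation.Binary.Bundles using (Setoid)
open import Relation.Binary.Definitions using (DecidableEquality)
open import Relation.Binary.PropositionalEquality
  using (_≡_; _≢_; refl; sym; trans; cong; cong₂; subst; module ≡-Reasoning)
import Relation.Binary.Reasoning.Setoid as SetoidReasoning
open import Relation.Binary.Structures using (IsEquivalence)
open import Relation.Nullary using (¬_; Dec; yes; no; ¬?; contradiction)
open import Relation.Nullary.Decidable using (_×-dec_; ⌊_⌋; does; isYes≗does; dec-true)
open import Relation.Unary using (Decidable)

module Congruence (q : ℕ) .{{_ : NonZero q}} where

  infix 4 _≈_ _≉_
  record _≈_ (m n : ℕ) : Set where
    constructor mk≈
    field %-≡ : m % q ≡ n % q

  _≉_ : ℕ → ℕ → Set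
  m ≉ n = ¬ m ≈ n

  ≈-isEquivalence : IsEquivalence _≈_
  ≈-isEquivalence = record
    { refl = mk≈ refl
    ; sym = λ (mk≈ e) → mk≈ (sym e)
    ; trans = λ (mk≈ e) (mk≈ f) → mk≈ (trans e f)
    }

  ≈-setoid : Setoid 0ℓ 0ℓ
  ≈-setoid = record { isEquivalence = ≈-isEquivalence }

  open IsEquivalence ≈-isEquivalence public
    using () renaming (refl to ≈-refl; sym to ≈-sym; trans to ≈-trans)

  ≈-reflexive : ∀ {m n} → m ≡ n → m ≈ n
  ≈-reflexive refl = ≈-refl

  m%q≈m : ∀ m → m % q ≈ m
  m%q≈m m = mk≈ (m%n%n≡m%n m q)

  q≈0 : q ≈ 0
  q≈0 = mk≈ (trans (n%n≡0 q) (sym (m*n%n≡0 0 q)))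

  +-cong : ∀ {m m′ n n′} → m ≈ m′ → n ≈ n′ → m + n ≈ m′ + n′
  +-cong {m} {m′} {n} {n′} (mk≈ e) (mk≈ f) = mk≈ (begin
    (m + n) % q               ≡⟨ %-distribˡ-+ m n q ⟩
    (m % q + n % q) % q       ≡⟨ cong₂ (λ x y → (x + y) % q) e f ⟩
    (m′ % q + n′ % q) % q     ≡⟨ %-distribˡ-+ m′ n′ q ⟨
    (m′ + n′) % q             ∎)
    where open ≡-Reasoning

  *-cong : ∀ {m m′ n n′} → m ≈ m′ → n ≈ n′ → m * n ≈ m′ * n′
  *-cong {m} {m′} {n} {n′} (mk≈ e) (mk≈ f) = mk≈ (begin
    (m * n) % q               ≡⟨ %-distribˡ-* m n q ⟩
    (m % q * (n % q)) % q     ≡⟨ cong₂ (λ x y → (x * y) % q) e f ⟩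
    (m′ % q * (n′ % q)) % q   ≡⟨ %-distribˡ-* m′ n′ q ⟨
    (m′ * n′) % q             ∎)
    where open ≡-Reasoning

  +-cancelˡ : ∀ m {n o} → m + n ≈ m + o → n ≈ o
  +-cancelˡ m {n} {o} m+n≈m+o = begin
    n                 ≈⟨ shift n ⟨
    (m′ + m) + n      ≡⟨ +-assoc m′ m n ⟩
    m′ + (m + n)      ≈⟨ +-cong (≈-refl {m′}) m+n≈m+o ⟩
    m′ + (m + o)      ≡⟨ +-assoc m′ m o ⟨
    (m′ + m) + o      ≈⟨ shift o ⟩
    o                 ∎
    where
    open SetoidReasoning ≈-setoid
    m′ : ℕ
    m′ = q ∸ m % q
    shift : ∀ k → (m′ + m) + k ≈ k
    shift k = +-cong (begin
      m′ + m          ≈⟨ +-cong (≈-refl {m′}) (m%q≈m m) ⟨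
      m′ + m % q      ≡⟨ m∸n+n≡m (<⇒≤ (m%n<n m q)) ⟩
      q               ≈⟨ q≈0 ⟩
      0               ∎) (≈-refl {k})

  +-cancelʳ : ∀ m {n o} → n + m ≈ o + m → n ≈ o
  +-cancelʳ m {n} {o} n+m≈o+m =
    +-cancelˡ m (≈-trans (≈-reflexive (+-comm m n)) (≈-trans n+m≈o+m (≈-reflexive (+-comm o m))))

  ∣⇒≈0 : ∀ {m} → q ∣ m → m ≈ 0
  ∣⇒≈0 {m} q∣m = mk≈ (trans (n∣m⇒m%n≡0 m q q∣m) (sym (m*n%n≡0 0 q)))

  ≈0⇒∣ : ∀ {m} → m ≈ 0 → q ∣ m
  ≈0⇒∣ {m} (mk≈ e) = m%n≡0⇒n∣m m q (trans e (m*n%n≡0 0 q))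

  ≈⇒≡ : ∀ {m n} → m < q → n < q → m ≈ n → m ≡ n
  ≈⇒≡ {m} {n} m<q n<q (mk≈ e) = trans (sym (m<n⇒m%n≡m m<q)) (trans e (m<n⇒m%n≡m n<q))

module PrimeCongruence (q : ℕ) (q-prime : Prime q) where

  private instance
    q≢0 : NonZero q
    q≢0 = prime⇒nonZero q-prime

  open Congruence q

  private
    *-cancelˡ-ordered : ∀ x {u v} → x ≉ 0 → u ≤ v → x * u ≈ x * v → u ≈ v
    *-cancelˡ-ordered x {u} {v} x≉0 u≤v xu≈xv
      with euclidsLemma x (v ∸ u) q-prime (≈0⇒∣ x[v∸u]≈0)
      where
      open SetoidReasoning ≈-setoid
      x[v∸u]≈0 : x * (v ∸ u) ≈ 0
      x[v∸u]≈0 = +-cancelˡ (x * u) (begin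
        x * u + x * (v ∸ u)   ≡⟨ *-distribˡ-+ x u (v ∸ u) ⟨
        x * (u + (v ∸ u))     ≡⟨ cong (x *_) (m+[n∸m]≡n u≤v) ⟩
        x * v                 ≈⟨ xu≈xv ⟨
        x * u                 ≡⟨ +-identityʳ (x * u) ⟨
        x * u + 0             ∎)
    ... | inj₁ q∣x   = contradiction (∣⇒≈0 q∣x) x≉0
    ... | inj₂ q∣v∸u = begin
      u             ≡⟨ +-identityʳ u ⟨
      u + 0         ≈⟨ +-cong (≈-refl {u}) (∣⇒≈0 q∣v∸u) ⟨
      u + (v ∸ u)   ≡⟨ m+[n∸m]≡n u≤v ⟩
      v             ∎
      where open SetoidReasoning ≈-setoid

  *-cancelˡ : ∀ x {u v} → x ≉ 0 → x * u ≈ x * v → u ≈ v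
  *-cancelˡ x {u} {v} x≉0 xu≈xv with ≤-total u v
  ... | inj₁ u≤v = *-cancelˡ-ordered x x≉0 u≤v xu≈xv
  ... | inj₂ v≤u = ≈-sym (*-cancelˡ-ordered x x≉0 v≤u (≈-sym xu≈xv))

module Lines (n : ℕ) (q-prime : Prime (suc n)) where

  open ZMod (suc n) {{prime⇒nonZero q-prime}}
  open Congruence (suc n)
  open PrimeCongruence (suc n) q-prime

  infixl 6 _+[_]·_
  _+[_]·_ : F → F → F → F
  a +[ ξ ]· b = a ⊕ ξ ⊗ b

  toℕ-mod : ∀ m → toℕ (m mod suc n) ≈ m
  toℕ-mod m = ≈-trans (≈-reflexive (toℕ-fromℕ< (m%n<n m (suc n)))) (m%q≈m m)

  toℕ-⊕ : ∀ a b → toℕ (a ⊕ b) ≈ toℕ a + toℕ b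
  toℕ-⊕ a b = toℕ-mod (toℕ a + toℕ b)

  toℕ-⊗ : ∀ a b → toℕ (a ⊗ b) ≈ toℕ a * toℕ b
  toℕ-⊗ a b = toℕ-mod (toℕ a * toℕ b)

  toℕ-⊖ : ∀ a b → toℕ (a ⊖ b) + toℕ b ≈ toℕ a
  toℕ-⊖ a b = begin
    toℕ (a ⊖ b) + toℕ b                 ≈⟨ +-cong (toℕ-mod (toℕ a + (suc n ∸ toℕ b))) (≈-refl {toℕ b}) ⟩
    toℕ a + (suc n ∸ toℕ b) + toℕ b     ≡⟨ +-assoc (toℕ a) (suc n ∸ toℕ b) (toℕ b) ⟩
    toℕ a + (suc n ∸ toℕ b + toℕ b)     ≡⟨ cong (toℕ a +_) (m∸n+n≡m (<⇒≤ (toℕ<n b))) ⟩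
    toℕ a + suc n                       ≈⟨ +-cong (≈-refl {toℕ a}) q≈0 ⟩
    toℕ a + 0                           ≡⟨ +-identityʳ (toℕ a) ⟩
    toℕ a                               ∎
    where open SetoidReasoning ≈-setoid

  toℕ-+[]· : ∀ a ξ b → toℕ (a +[ ξ ]· b) ≈ toℕ a + toℕ ξ * toℕ b
  toℕ-+[]· a ξ b = ≈-trans (toℕ-⊕ a (ξ ⊗ b)) (+-cong (≈-refl {toℕ a}) (toℕ-⊗ ξ b))

  toℕ-≈-injective : ∀ {a b} → toℕ a ≈ toℕ b → a ≡ b
  toℕ-≈-injective {a} {b} = toℕ-injective ∘ ≈⇒≡ (toℕ<n a) (toℕ<n b)

  ≢zero⇒toℕ≉0 : ∀ {a} → a ≢ zero → toℕ a ≉ 0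
  ≢zero⇒toℕ≉0 a≢0 toℕa≈0 = a≢0 (toℕ-≈-injective toℕa≈0)

  ⊖-≢-zero : ∀ {b d} → b ≢ d → b ⊖ d ≢ zero
  ⊖-≢-zero {b} {d} b≢d b⊖d≡0 = b≢d (toℕ-≈-injective (begin
    toℕ b                  ≈⟨ toℕ-⊖ b d ⟨
    toℕ (b ⊖ d) + toℕ d    ≡⟨ cong (λ x → toℕ x + toℕ d) b⊖d≡0 ⟩
    toℕ d                  ∎))
    where open SetoidReasoning ≈-setoid

  +[]·-cancelˡ : ∀ {ξ a b c} → a +[ ξ ]· b ≡ c +[ ξ ]· b → a ≡ c
  +[]·-cancelˡ {ξ} {a} {b} {c} e = toℕ-≈-injective (+-cancelʳ (toℕ ξ * toℕ b) (begin
    toℕ a + toℕ ξ * toℕ b   ≈⟨ toℕ-+[]· a ξ b ⟨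
    toℕ (a +[ ξ ]· b)       ≡⟨ cong toℕ e ⟩
    toℕ (c +[ ξ ]· b)       ≈⟨ toℕ-+[]· c ξ b ⟩
    toℕ c + toℕ ξ * toℕ b   ∎))
    where open SetoidReasoning ≈-setoid

  +[]·-cancelʳ : ∀ {ξ a b d} → ξ ≢ zero → a +[ ξ ]· b ≡ a +[ ξ ]· d → b ≡ d
  +[]·-cancelʳ {ξ} {a} {b} {d} ξ≢0 e =
    toℕ-≈-injective (*-cancelˡ (toℕ ξ) (≢zero⇒toℕ≉0 ξ≢0) (+-cancelˡ (toℕ a) (begin
      toℕ a + toℕ ξ * toℕ b   ≈⟨ toℕ-+[]· a ξ b ⟨
      toℕ (a +[ ξ ]· b)       ≡⟨ cong toℕ e ⟩
      toℕ (a +[ ξ ]· d)       ≈⟨ toℕ-+[]· a ξ d ⟩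
      toℕ a + toℕ ξ * toℕ d   ∎)))
    where open SetoidReasoning ≈-setoid

  +[]·-slope : ∀ {ξ a b c d} → a +[ ξ ]· b ≡ c +[ ξ ]· d → ξ ⊗ (b ⊖ d) ≡ c ⊖ a
  +[]·-slope {ξ} {a} {b} {c} {d} e = toℕ-≈-injective (+-cancelʳ (toℕ a + X * D) (begin
    toℕ (ξ ⊗ (b ⊖ d)) + (toℕ a + X * D)   ≈⟨ +-cong (toℕ-⊗ ξ (b ⊖ d)) (≈-refl {toℕ a + X * D}) ⟩
    X * B + (toℕ a + X * D)               ≡⟨ regroup X B (toℕ a) D ⟩
    toℕ a + X * (B + D)                   ≈⟨ +-cong (≈-refl {toℕ a}) (*-cong (≈-refl {X}) (toℕ-⊖ b d)) ⟩
    toℕ a + X * toℕ b                     ≈⟨ toℕ-+[]· a ξ b ⟨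
    toℕ (a +[ ξ ]· b)                     ≡⟨ cong toℕ e ⟩
    toℕ (c +[ ξ ]· d)                     ≈⟨ toℕ-+[]· c ξ d ⟩
    toℕ c + X * D                         ≈⟨ +-cong (toℕ-⊖ c a) (≈-refl {X * D}) ⟨
    toℕ (c ⊖ a) + toℕ a + X * D           ≡⟨ +-assoc (toℕ (c ⊖ a)) (toℕ a) (X * D) ⟩
    toℕ (c ⊖ a) + (toℕ a + X * D)         ∎))
    where
    open SetoidReasoning ≈-setoid
    X B D : ℕ
    X = toℕ ξ
    B = toℕ (b ⊖ d)
    D = toℕ d
    regroup : ∀ X B a D → X * B + (a + X * D) ≡ a + X * (B + D)
    regroup = solve-∀

  slope-unique : ∀ {ξ η a b c d} → b ≢ d →
    a +[ ξ ]· b ≡ c +[ ξ ]· d → a +[ η ]· b ≡ c +[ η ]· d → ξ ≡ η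
  slope-unique {ξ} {η} {a} {b} {c} {d} b≢d eξ eη =
    toℕ-≈-injective (*-cancelˡ (toℕ (b ⊖ d)) (≢zero⇒toℕ≉0 (⊖-≢-zero b≢d)) (begin
      toℕ (b ⊖ d) * toℕ ξ     ≡⟨ *-comm (toℕ (b ⊖ d)) (toℕ ξ) ⟩
      toℕ ξ * toℕ (b ⊖ d)     ≈⟨ toℕ-⊗ ξ (b ⊖ d) ⟨
      toℕ (ξ ⊗ (b ⊖ d))       ≡⟨ cong toℕ (trans (+[]·-slope {ξ} {a} {b} {c} {d} eξ) (sym (+[]·-slope {η} {a} {b} {c} {d} eη))) ⟩
      toℕ (η ⊗ (b ⊖ d))       ≈⟨ toℕ-⊗ η (b ⊖ d) ⟩
      toℕ η * toℕ (b ⊖ d)     ≡⟨ *-comm (toℕ η) (toℕ (b ⊖ d)) ⟩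
      toℕ (b ⊖ d) * toℕ η     ∎))
    where open SetoidReasoning ≈-setoid

  scaled-+[]· : ∀ {ξ x a b c d} → x ≢ zero →
    a ⊗ x ⊕ b ⊗ (ξ ⊗ x) ≡ c ⊗ x ⊕ d ⊗ (ξ ⊗ x) → a +[ ξ ]· b ≡ c +[ ξ ]· d
  scaled-+[]· {ξ} {x} {a} {b} {c} {d} x≢0 e =
    toℕ-≈-injective (*-cancelˡ (toℕ x) (≢zero⇒toℕ≉0 x≢0) (begin
      toℕ x * toℕ (a +[ ξ ]· b)        ≈⟨ scale a b ⟨
      toℕ (a ⊗ x ⊕ b ⊗ (ξ ⊗ x))        ≡⟨ cong toℕ e ⟩
      toℕ (c ⊗ x ⊕ d ⊗ (ξ ⊗ x))        ≈⟨ scale c d ⟩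
      toℕ x * toℕ (c +[ ξ ]· d)        ∎))
    where
    open SetoidReasoning ≈-setoid
    regroup : ∀ a x b X → a * x + b * (X * x) ≡ x * (a + X * b)
    regroup = solve-∀
    scale : ∀ a b → toℕ (a ⊗ x ⊕ b ⊗ (ξ ⊗ x)) ≈ toℕ x * toℕ (a +[ ξ ]· b)
    scale a b = begin
      toℕ (a ⊗ x ⊕ b ⊗ (ξ ⊗ x))                       ≈⟨ toℕ-⊕ (a ⊗ x) (b ⊗ (ξ ⊗ x)) ⟩
      toℕ (a ⊗ x) + toℕ (b ⊗ (ξ ⊗ x))                 ≈⟨ +-cong (toℕ-⊗ a x) (≈-trans (toℕ-⊗ b (ξ ⊗ x)) (*-cong (≈-refl {toℕ b}) (toℕ-⊗ ξ x))) ⟩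
      toℕ a * toℕ x + toℕ b * (toℕ ξ * toℕ x)         ≡⟨ regroup (toℕ a) (toℕ x) (toℕ b) (toℕ ξ) ⟩
      toℕ x * (toℕ a + toℕ ξ * toℕ b)                 ≈⟨ *-cong (≈-refl {toℕ x}) (toℕ-+[]· a ξ b) ⟨
      toℕ x * toℕ (a +[ ξ ]· b)                       ∎

private variable
  A B : Set

∑ : List A → (A → ℕ) → ℕ
∑ []       h = 0
∑ (x ∷ xs) h = h x + ∑ xs h

∑-cong : ∀ (xs : List A) {g h : A → ℕ} → (∀ {x} → x ∈ xs → g x ≡ h x) → ∑ xs g ≡ ∑ xs h
∑-cong []       g≗h = refl
∑-cong (x ∷ xs) g≗h = cong₂ _+_ (g≗h (here refl)) (∑-cong xs (g≗h ∘ there))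

∑-mono-≤ : ∀ (xs : List A) {g h : A → ℕ} → (∀ {x} → x ∈ xs → g x ≤ h x) → ∑ xs g ≤ ∑ xs h
∑-mono-≤ []       g≤h = z≤n
∑-mono-≤ (x ∷ xs) g≤h = +-mono-≤ (g≤h (here refl)) (∑-mono-≤ xs (g≤h ∘ there))

∑-const : ∀ (xs : List A) c → ∑ xs (λ _ → c) ≡ length xs * c
∑-const []       c = refl
∑-const (x ∷ xs) c = cong (c +_) (∑-const xs c)

∑-zero : ∀ (xs : List A) {h : A → ℕ} → (∀ {x} → x ∈ xs → h x ≡ 0) → ∑ xs h ≡ 0
∑-zero xs h≗0 = trans (∑-cong xs h≗0) (trans (∑-const xs 0) (*-zeroʳ (length xs)))

∑-+ : ∀ (xs : List A) (g h : A → ℕ) → ∑ xs (λ x → g x + h x) ≡ ∑ xs g + ∑ xs h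
∑-+ []       g h = refl
∑-+ (x ∷ xs) g h = trans (cong (g x + h x +_) (∑-+ xs g h)) (interchange (g x) (h x) (∑ xs g) (∑ xs h))
  where
  interchange : ∀ a b c d → a + b + (c + d) ≡ a + c + (b + d)
  interchange = solve-∀

∑-*ˡ : ∀ (xs : List A) c (h : A → ℕ) → ∑ xs (λ x → c * h x) ≡ c * ∑ xs h
∑-*ˡ []       c h = sym (*-zeroʳ c)
∑-*ˡ (x ∷ xs) c h = trans (cong (c * h x +_) (∑-*ˡ xs c h)) (sym (*-distribˡ-+ c (h x) (∑ xs h)))

∑-swap : ∀ (xs : List A) (ys : List B) (h : A → B → ℕ) →
  ∑ xs (λ x → ∑ ys (h x)) ≡ ∑ ys (λ y → ∑ xs (λ x → h x y))
∑-swap []       ys h = sym (∑-zero ys (λ _ → refl))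
∑-swap (x ∷ xs) ys h =
  trans (cong (∑ ys (h x) +_) (∑-swap xs ys h)) (sym (∑-+ ys (h x) (λ y → ∑ xs (λ x′ → h x′ y))))

∑-++ : ∀ (xs ys : List A) (h : A → ℕ) → ∑ (xs ++ ys) h ≡ ∑ xs h + ∑ ys h
∑-++ []       ys h = refl
∑-++ (x ∷ xs) ys h = trans (cong (h x +_) (∑-++ xs ys h)) (sym (+-assoc (h x) (∑ xs h) (∑ ys h)))

∑-map : ∀ (f : A → B) (xs : List A) (h : B → ℕ) → ∑ (map f xs) h ≡ ∑ xs (h ∘ f)
∑-map f []       h = refl
∑-map f (x ∷ xs) h = cong (h (f x) +_) (∑-map f xs h)

∑-cartesianProduct-* : ∀ (xs : List A) (ys : List B) (g : A → ℕ) (h : B → ℕ) →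
  ∑ (cartesianProduct xs ys) (λ (x , y) → g x * h y) ≡ ∑ xs g * ∑ ys h
∑-cartesianProduct-* []       ys g h = refl
∑-cartesianProduct-* (x ∷ xs) ys g h = begin
  ∑ (map (x ,_) ys ++ cartesianProduct xs ys) (λ (x , y) → g x * h y)
    ≡⟨ ∑-++ (map (x ,_) ys) (cartesianProduct xs ys) _ ⟩
  ∑ (map (x ,_) ys) (λ (x , y) → g x * h y) + ∑ (cartesianProduct xs ys) (λ (x , y) → g x * h y)
    ≡⟨ cong₂ _+_ (trans (∑-map (x ,_) ys _) (∑-*ˡ ys (g x) h)) (∑-cartesianProduct-* xs ys g h) ⟩
  g x * ∑ ys h + ∑ xs g * ∑ ys h
    ≡⟨ *-distribʳ-+ (∑ ys h) (g x) (∑ xs g) ⟨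
  (g x + ∑ xs g) * ∑ ys h
    ∎
  where open ≡-Reasoning

∈⇒≤∑ : ∀ {xs : List A} (h : A → ℕ) {x} → x ∈ xs → h x ≤ ∑ xs h
∈⇒≤∑ {xs = y ∷ xs} h (here refl) = m≤m+n (h y) (∑ xs h)
∈⇒≤∑ {xs = y ∷ xs} h (there x∈xs) = ≤-trans (∈⇒≤∑ h x∈xs) (m≤n+m (∑ xs h) (h y))

∑-positive : ∀ (xs : List A) (h : A → ℕ) → 0 < ∑ xs h → ∃ λ x → x ∈ xs × 0 < h x
∑-positive (x ∷ xs) h ∑>0 with h x in hx≡
... | suc _ = x , here refl , subst (0 <_) (sym hx≡) z<s
... | zero  = let y , y∈xs , hy>0 = ∑-positive xs h ∑>0 in y , there y∈xs , hy>0

∃≤average : ∀ (xs : List A) (h : A → ℕ) → 0 < length xs → ∃ λ y → y ∈ xs × length xs * h y ≤ ∑ xs h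
∃≤average (x ∷ xs) h _ = go x xs
  where
  go : ∀ x xs → ∃ λ y → y ∈ x ∷ xs × length (x ∷ xs) * h y ≤ ∑ (x ∷ xs) h
  go x []        = x , here refl , ≤-refl
  go x (x′ ∷ xs) with go x′ xs
  ... | y , y∈ , avg with h x ≤? h y
  ...   | yes hx≤hy = x , here refl , +-monoʳ-≤ (h x) (≤-trans (*-monoʳ-≤ (length (x′ ∷ xs)) hx≤hy) avg)
  ...   | no  hx≰hy = y , there y∈ , +-mono-≤ (<⇒≤ (≰⇒> hx≰hy)) avg

𝟙 : {P : Set} → Dec P → ℕ
𝟙 (yes _) = 1
𝟙 (no _)  = 0

module _ {P : Set} where

  𝟙-yes : (P? : Dec P) → P → 𝟙 P? ≡ 1
  𝟙-yes (yes _) _  = refl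
  𝟙-yes (no ¬p) p  = contradiction p ¬p

  𝟙-no : (P? : Dec P) → ¬ P → 𝟙 P? ≡ 0
  𝟙-no (yes p) ¬p = contradiction p ¬p
  𝟙-no (no _)  _  = refl

  𝟙-positive : (P? : Dec P) → 0 < 𝟙 P? → P
  𝟙-positive (yes p) _ = p

module _ {P Q : Set} where

  𝟙-mono : (P? : Dec P) (Q? : Dec Q) → (P → Q) → 𝟙 P? ≤ 𝟙 Q?
  𝟙-mono (no _)  _       _   = z≤n
  𝟙-mono (yes p) Q?      P⇒Q = ≤-reflexive (sym (𝟙-yes Q? (P⇒Q p)))

  𝟙-× : (P? : Dec P) (Q? : Dec Q) → 𝟙 (P? ×-dec Q?) ≡ 𝟙 P? * 𝟙 Q?
  𝟙-× (yes _) (yes _) = refl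
  𝟙-× (yes _) (no _)  = refl
  𝟙-× (no _)  _       = refl

∑-𝟙-≤1 : ∀ {xs : List A} {P : A → Set} (P? : Decidable P) → Unique xs →
  (∀ {x y} → P x → P y → x ≡ y) → ∑ xs (𝟙 ∘ P?) ≤ 1
∑-𝟙-≤1 {xs = []}     P? _            _   = z≤n
∑-𝟙-≤1 {xs = x ∷ xs} P? (x∉xs ∷ xs!) unique with P? x
... | no _  = ∑-𝟙-≤1 P? xs! unique
... | yes px = ≤-reflexive (cong suc (∑-zero xs λ {y} y∈xs →
                 𝟙-no (P? y) (λ py → All.lookup x∉xs y∈xs (unique px py))))

∑-𝟙-≢ : (_≟_ : DecidableEquality A) {xs : List A} {a : A} → Unique xs → a ∈ xs →
  suc (∑ xs (λ c → 𝟙 (¬? (a ≟ c)))) ≡ length xs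
∑-𝟙-≢ _≟_ {x ∷ xs} (x∉xs ∷ _) (here refl) = cong suc (begin
  𝟙 (¬? (x ≟ x)) + ∑ xs (λ c → 𝟙 (¬? (x ≟ c)))   ≡⟨ cong (_+ ∑ xs (λ c → 𝟙 (¬? (x ≟ c)))) (𝟙-no (¬? (x ≟ x)) (λ x≢x → x≢x refl)) ⟩
  ∑ xs (λ c → 𝟙 (¬? (x ≟ c)))                    ≡⟨ ∑-cong xs (λ c∈xs → 𝟙-yes (¬? (x ≟ _)) (All.lookup x∉xs c∈xs)) ⟩
  ∑ xs (λ _ → 1)                                 ≡⟨ ∑-const xs 1 ⟩
  length xs * 1                                  ≡⟨ *-identityʳ (length xs) ⟩
  length xs                                      ∎)
  where open ≡-Reasoning
∑-𝟙-≢ _≟_ {x ∷ xs} {a} (x∉xs ∷ xs!) (there a∈xs) with a ≟ x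
... | yes refl = contradiction refl (All.lookup x∉xs a∈xs)
... | no _     = cong suc (∑-𝟙-≢ _≟_ xs! a∈xs)

length-cartesianProduct : ∀ (xs : List A) (ys : List B) →
  length (cartesianProduct xs ys) ≡ length xs * length ys
length-cartesianProduct []       ys = refl
length-cartesianProduct (x ∷ xs) ys = trans (length-++ (map (x ,_) ys))
  (cong₂ _+_ (length-map (x ,_) ys) (length-cartesianProduct xs ys))

∈-─ : ∀ {x z : A} (ys : List A) (x∈ys : x ∈ ys) → z ∈ ys → z ≢ x → z ∈ (ys ─ x∈ys)
∈-─ (y ∷ ys) (here refl)  (here refl)  z≢x = contradiction refl z≢x
∈-─ (y ∷ ys) (here refl)  (there z∈ys) _   = z∈ys
∈-─ (y ∷ ys) (there x∈ys) (here refl)  _   = here refl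
∈-─ (y ∷ ys) (there x∈ys) (there z∈ys) z≢x = there (∈-─ ys x∈ys z∈ys z≢x)

unique-⊆⇒length-≤ : ∀ {xs ys : List A} → Unique xs → (∀ {x} → x ∈ xs → x ∈ ys) → length xs ≤ length ys
unique-⊆⇒length-≤ {xs = []}                  _             _     = z≤n
unique-⊆⇒length-≤ {xs = x ∷ xs} {ys} (x∉xs ∷ xs!) xs⊆ys = begin
  suc (length xs)          ≤⟨ s≤s (unique-⊆⇒length-≤ xs! xs⊆ys─x) ⟩
  suc (length (ys ─ x∈ys)) ≡⟨ length-removeAt′ ys (index x∈ys) ⟨
  length ys                ∎
  where
  open ≤-Reasoning
  x∈ys : x ∈ ys
  x∈ys = xs⊆ys (here refl)
  xs⊆ys─x : ∀ {z} → z ∈ xs → z ∈ (ys ─ x∈ys)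
  xs⊆ys─x z∈xs = ∈-─ ys x∈ys (xs⊆ys (there z∈xs)) (λ z≡x → All.lookup x∉xs z∈xs (sym z≡x))

elements : ∀ {n} → Subset n → List (Fin n)
elements []          = []
elements (true ∷ p)  = zero ∷ map suc (elements p)
elements (false ∷ p) = map suc (elements p)

length-elements : ∀ {n} (p : Subset n) → length (elements p) ≡ ∣ p ∣
length-elements []          = refl
length-elements (true ∷ p)  = cong suc (trans (length-map suc (elements p)) (length-elements p))
length-elements (false ∷ p) = trans (length-map suc (elements p)) (length-elements p)

∈-elements⁺ : ∀ {n} (p : Subset n) {x} → x ∈ₛ p → x ∈ elements p
∈-elements⁺ (true ∷ p)  here         = here refl
∈-elements⁺ (true ∷ p)  (there x∈p)  = there (∈-map⁺ suc (∈-elements⁺ p x∈p))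
∈-elements⁺ (false ∷ p) (there x∈p)  = ∈-map⁺ suc (∈-elements⁺ p x∈p)

∈-elements⁻ : ∀ {n} (p : Subset n) {x} → x ∈ elements p → x ∈ₛ p
∈-elements⁻ (true ∷ p)  (here refl) = here
∈-elements⁻ (true ∷ p)  (there x∈)  with ∈-map⁻ suc x∈
... | y , y∈ , refl = there (∈-elements⁻ p y∈)
∈-elements⁻ (false ∷ p) x∈          with ∈-map⁻ suc x∈
... | y , y∈ , refl = there (∈-elements⁻ p y∈)

elements-unique : ∀ {n} (p : Subset n) → Unique (elements p)
elements-unique []          = []
elements-unique (true ∷ p)  = All.tabulate zero∉ ∷ Unique.map⁺ Fin.suc-injective (elements-unique p)
  where
  zero∉ : ∀ {z} → z ∈ map suc (elements p) → zero ≢ z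
  zero∉ z∈ with ∈-map⁻ suc z∈
  ... | _ , _ , refl = λ ()
elements-unique (false ∷ p) = Unique.map⁺ Fin.suc-injective (elements-unique p)

unique-⊆-subset⇒length-≤ : ∀ {n} {xs : List (Fin n)} (p : Subset n) → Unique xs →
  (∀ {x} → x ∈ xs → x ∈ₛ p) → length xs ≤ ∣ p ∣
unique-⊆-subset⇒length-≤ p xs! xs⊆p = ≤-trans
  (unique-⊆⇒length-≤ xs! (∈-elements⁺ p ∘ xs⊆p)) (≤-reflexive (length-elements p))

∃-unique-list-in-subset : ∀ {n} (p : Subset n) {k} → k ≤ ∣ p ∣ →
  ∃ λ L → Unique L × length L ≡ k × (∀ {x} → x ∈ L → x ∈ₛ p)
∃-unique-list-in-subset p {k} k≤∣p∣ =
  take k (elements p) ,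
  Unique.take⁺ k (elements-unique p) ,
  trans (length-take k (elements p)) (m≤n⇒m⊓n≡m (subst (k ≤_) (sym (length-elements p)) k≤∣p∣)) ,
  ∈-elements⁻ p ∘ Sublist.lookup (Sublist.take-⊆ k (elements p))

module Collisions {A B : Set} (_≟A_ : DecidableEquality A) (_≟B_ : DecidableEquality B) (f : A → B) where

  open import Data.List.Membership.DecPropositional _≟B_ using (_∈?_)

  image : List A → List B
  image []       = []
  image (x ∷ xs) with f x ∈? image xs
  ... | yes _ = image xs
  ... | no  _ = f x ∷ image xs

  ∈-image⁻ : ∀ xs {y} → y ∈ image xs → ∃ λ x → x ∈ xs × f x ≡ y
  ∈-image⁻ (x ∷ xs) y∈ with f x ∈? image xs
  ∈-image⁻ (x ∷ xs) y∈         | yes _ = let z , z∈ , fz≡y = ∈-image⁻ xs y∈ in z , there z∈ , fz≡y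
  ∈-image⁻ (x ∷ xs) (here y≡)  | no _  = x , here refl , sym y≡
  ∈-image⁻ (x ∷ xs) (there y∈) | no _  = let z , z∈ , fz≡y = ∈-image⁻ xs y∈ in z , there z∈ , fz≡y

  image-unique : ∀ xs → Unique (image xs)
  image-unique []       = []
  image-unique (x ∷ xs) with f x ∈? image xs
  ... | yes _     = image-unique xs
  ... | no  fx∉ = All.tabulate (λ z∈ fx≡z → fx∉ (subst (_∈ image xs) (sym fx≡z) z∈)) ∷ image-unique xs

  Collide : A → A → Set
  Collide x y = x ≢ y × f x ≡ f y

  collide? : ∀ x y → Dec (Collide x y)
  collide? x y = ¬? (x ≟A y) ×-dec (f x ≟B f y)

  collisions : List A → ℕ
  collisions xs = ∑ xs λ x → ∑ xs λ y → 𝟙 (collide? x y)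

  row column : A → List A → ℕ
  row    x xs = ∑ xs (λ y → 𝟙 (collide? x y))
  column x xs = ∑ xs (λ y → 𝟙 (collide? y x))

  collisions-∷ : ∀ x xs → row x xs + column x xs + collisions xs ≤ collisions (x ∷ xs)
  collisions-∷ x xs = begin
    row x xs + column x xs + collisions xs                        ≡⟨ +-assoc (row x xs) (column x xs) (collisions xs) ⟩
    row x xs + (column x xs + collisions xs)                      ≤⟨ m≤n+m _ (𝟙 (collide? x x)) ⟩
    𝟙 (collide? x x) + (row x xs + (column x xs + collisions xs)) ≡⟨ +-assoc (𝟙 (collide? x x)) (row x xs) _ ⟨
    𝟙 (collide? x x) + row x xs + (column x xs + collisions xs)   ≡⟨ cong (𝟙 (collide? x x) + row x xs +_)
                                                                       (∑-+ xs (λ y → 𝟙 (collide? y x)) (λ y → row y xs)) ⟨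
    collisions (x ∷ xs)                                           ∎
    where open ≤-Reasoning

  length-≤-image+collisions : ∀ xs → Unique xs → 2 * length xs ≤ 2 * length (image xs) + collisions xs
  length-≤-image+collisions []       _            = z≤n
  length-≤-image+collisions (x ∷ xs) (x∉xs ∷ xs!) with f x ∈? image xs | length-≤-image+collisions xs xs!
  ... | yes fx∈ | ih = begin
    2 * suc (length xs)                                ≡⟨ *-suc 2 (length xs) ⟩
    2 + 2 * length xs                                  ≤⟨ +-monoʳ-≤ 2 ih ⟩
    2 + (2 * length (image xs) + collisions xs)        ≡⟨ move-2 (2 * length (image xs)) (collisions xs) ⟩
    2 * length (image xs) + (1 + 1 + collisions xs)    ≤⟨ +-monoʳ-≤ (2 * length (image xs))
                                                            (+-monoˡ-≤ (collisions xs) (+-mono-≤ row≥1 column≥1)) ⟩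
    2 * length (image xs) + (row x xs + column x xs + collisions xs)
                                                       ≤⟨ +-monoʳ-≤ (2 * length (image xs)) (collisions-∷ x xs) ⟩
    2 * length (image xs) + collisions (x ∷ xs)        ∎
    where
    open ≤-Reasoning
    move-2 : ∀ m c → 2 + (m + c) ≡ m + (2 + c)
    move-2 = solve-∀
    -- f x was already hit by some y ∈ xs, and y ≢ x, so (x, y) and (y, x) are new collisions
    witness : ∃ λ y → y ∈ xs × f y ≡ f x
    witness = ∈-image⁻ xs fx∈
    y : A
    y = proj₁ witness
    y∈xs : y ∈ xs
    y∈xs = proj₁ (proj₂ witness)
    fy≡fx : f y ≡ f x
    fy≡fx = proj₂ (proj₂ witness)
    x≢y : x ≢ y
    x≢y = All.lookup x∉xs y∈xs
    row≥1 : 1 ≤ row x xs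
    row≥1 = ≤-trans (≤-reflexive (sym (𝟙-yes (collide? x y) (x≢y , sym fy≡fx)))) (∈⇒≤∑ (𝟙 ∘ collide? x) y∈xs)
    column≥1 : 1 ≤ column x xs
    column≥1 = ≤-trans (≤-reflexive (sym (𝟙-yes (collide? y x) (x≢y ∘ sym , fy≡fx))))
                 (∈⇒≤∑ (λ z → 𝟙 (collide? z x)) y∈xs)
  ... | no _ | ih = begin
    2 * suc (length xs)                                ≡⟨ *-suc 2 (length xs) ⟩
    2 + 2 * length xs                                  ≤⟨ +-monoʳ-≤ 2 ih ⟩
    2 + (2 * length (image xs) + collisions xs)        ≡⟨ +-assoc 2 (2 * length (image xs)) (collisions xs) ⟨
    2 + 2 * length (image xs) + collisions xs          ≡⟨ cong (_+ collisions xs) (*-suc 2 (length (image xs))) ⟨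
    2 * suc (length (image xs)) + collisions xs        ≤⟨ +-monoʳ-≤ (2 * suc (length (image xs)))
                                                            (≤-trans (m≤n+m (collisions xs) _) (collisions-∷ x xs)) ⟩
    2 * suc (length (image xs)) + collisions (x ∷ xs)  ∎
    where open ≤-Reasoning

  ∃-collision : ∀ {xs} → Unique xs → length (image xs) < length xs →
    ∃ λ x → ∃ λ y → x ∈ xs × y ∈ xs × Collide x y
  ∃-collision {xs} xs! image<xs =
    let x , x∈ , ∑>0 = ∑-positive xs _ collisions>0
        y , y∈ , 𝟙>0 = ∑-positive xs _ ∑>0
    in x , y , x∈ , y∈ , 𝟙-positive (collide? x y) 𝟙>0
    where
    collisions>0 : 0 < collisions xs
    collisions>0 = n≢0⇒n>0 λ collisions≡0 → <⇒≱ (*-monoʳ-< 2 image<xs) (begin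
      2 * length xs                          ≤⟨ length-≤-image+collisions xs xs! ⟩
      2 * length (image xs) + collisions xs  ≡⟨ cong (2 * length (image xs) +_) collisions≡0 ⟩
      2 * length (image xs) + 0              ≡⟨ +-identityʳ _ ⟩
      2 * length (image xs)                  ∎)
      where open ≤-Reasoning

  length-≤-2*image : ∀ {xs} → Unique xs → collisions xs ≤ length xs → length xs ≤ 2 * length (image xs)
  length-≤-2*image {xs} xs! few = +-cancelˡ-≤ (length xs) (length xs) (2 * length (image xs)) (begin
    length xs + length xs                  ≡⟨ cong (length xs +_) (+-identityʳ (length xs)) ⟨
    2 * length xs                          ≤⟨ length-≤-image+collisions xs xs! ⟩
    2 * length (image xs) + collisions xs  ≤⟨ +-monoʳ-≤ (2 * length (image xs)) few ⟩
    2 * length (image xs) + length xs      ≡⟨ +-comm (2 * length (image xs)) (length xs) ⟩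
    length xs + 2 * length (image xs)      ∎)
    where open ≤-Reasoning

square-not-prime : ∀ m → ¬ Prime (m * m)
square-not-prime 0                   = ¬prime[0]
square-not-prime 1                   = ¬prime[1]
square-not-prime m@(suc (suc m-2))   p = prime⇒¬composite p (composite (m<m*n m m (s≤s (s≤s z≤n))) (divides m refl))

∃-least-square-above : ∀ Q N → Q < N * N → ∃ λ k → k ≤ N × Q < k * k × (k ∸ 1) * (k ∸ 1) ≤ Q
∃-least-square-above Q (suc N) Q<[1+N]² with Q <? N * N
... | yes Q<N² = let k , k≤N , rest = ∃-least-square-above Q N Q<N² in k , m≤n⇒m≤1+n k≤N , rest
... | no  Q≮N² = suc N , ≤-refl , Q<[1+N]² , ≮⇒≥ Q≮N²

square≤prime⇒square<prime : ∀ m {p} → Prime p → m * m ≤ p → m * m < p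
square≤prime⇒square<prime m p-prime m²≤p with m≤n⇒m<n∨m≡n m²≤p
... | inj₁ m²<p = m²<p
... | inj₂ m²≡p = contradiction (subst Prime (sym m²≡p) p-prime) (square-not-prime m)

module Slopes (n : ℕ) (q-prime : Prime (suc n)) where

  open ZMod (suc n) {{prime⇒nonZero q-prime}}
  open Lines n q-prime

  InI⇒∈I : ∀ {A z} → InI A z → z ∈ₛ I A
  InI⇒∈I {A} {z} z∈I = lookup⇒[]= z (I A) (begin
    lookup (I A) z         ≡⟨ lookup∘tabulate (λ x → ⌊ InI? A x ⌋) z ⟩
    ⌊ InI? A z ⌋           ≡⟨ isYes≗does (InI? A z) ⟩
    does (InI? A z)        ≡⟨ dec-true (InI? A z) z∈I ⟩
    true                   ∎)
    where open ≡-Reasoning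

  private instance
    n≢0 : NonZero n
    n≢0 = >-nonZero (≤-pred (nonTrivial⇒n>1 (suc n) {{prime⇒nonTrivial q-prime}}))

  _≟²_ : DecidableEquality (F × F)
  _≟²_ = ×.≡-dec Fin._≟_ Fin._≟_

  line : F → F × F → F
  line ξ (a , b) = a +[ ξ ]· b

  Differ : F × F → F × F → Set
  Differ (a , b) (c , d) = a ≢ c × b ≢ d

  differ? : ∀ p p′ → Dec (Differ p p′)
  differ? (a , b) (c , d) = ¬? (a Fin.≟ c) ×-dec ¬? (b Fin.≟ d)

  Aligned : F → F × F → F × F → Set
  Aligned ξ p p′ = Differ p p′ × line ξ p ≡ line ξ p′

  aligned? : ∀ ξ p p′ → Dec (Aligned ξ p p′)
  aligned? ξ p p′ = differ? p p′ ×-dec (line ξ p Fin.≟ line ξ p′)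

  alignedPairs : F → List (F × F) → ℕ
  alignedPairs ξ D = ∑ D λ p → ∑ D λ p′ → 𝟙 (aligned? ξ p p′)

  line-collision⇒≢₂ : ∀ {ξ a b c d} → (a , b) ≢ (c , d) → line ξ (a , b) ≡ line ξ (c , d) → b ≢ d
  line-collision⇒≢₂ {ξ} {a} {b} {c} ab≢cd e refl = ab≢cd (cong (_, b) (+[]·-cancelˡ {ξ} {a} {b} {c} e))

  nonzero : List F
  nonzero = map suc (allFin n)

  nonzero-unique : Unique nonzero
  nonzero-unique = Unique.map⁺ Fin.suc-injective (Unique.allFin⁺ n)

  length-nonzero : length nonzero ≡ n
  length-nonzero = trans (length-map suc (allFin n)) (length-tabulate id)

  ∑-𝟙-aligned≤𝟙-differ : ∀ p p′ → ∑ nonzero (λ ξ → 𝟙 (aligned? ξ p p′)) ≤ 𝟙 (differ? p p′)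
  ∑-𝟙-aligned≤𝟙-differ p@(a , b) p′@(c , d) = bound (differ? p p′)
    where
    bound : (differ : Dec (Differ p p′)) → ∑ nonzero (λ ξ → 𝟙 (aligned? ξ p p′)) ≤ 𝟙 differ
    bound (yes (_ , b≢d)) = ∑-𝟙-≤1 (λ ξ → aligned? ξ p p′) nonzero-unique
                              λ (_ , eξ) (_ , eη) → slope-unique {a = a} {b} {c} {d} b≢d eξ eη
    bound (no ¬differ)    = ≤-reflexive (∑-zero nonzero λ {ξ} _ → 𝟙-no (aligned? ξ p p′) (¬differ ∘ proj₁))

  module _ (L : List F) (L-unique : Unique L) where

    k : ℕ
    k = length L

    D : List (F × F)
    D = cartesianProduct L L

    D-unique : Unique D
    D-unique = Unique.cartesianProduct⁺ L-unique L-unique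

    length-D : length D ≡ k * k
    length-D = length-cartesianProduct L L

    ∑-𝟙-differ : ∀ {p} → p ∈ D → ∑ D (𝟙 ∘ differ? p) ≡ (k ∸ 1) * (k ∸ 1)
    ∑-𝟙-differ {a , b} p∈D = begin
      ∑ D (𝟙 ∘ differ? (a , b))                    ≡⟨ ∑-cong D (λ {(c , d)} _ → 𝟙-× (¬? (a Fin.≟ c)) (¬? (b Fin.≟ d))) ⟩
      ∑ D (λ (c , d) → 𝟙 (¬? (a Fin.≟ c)) * 𝟙 (¬? (b Fin.≟ d)))
                                                   ≡⟨ ∑-cartesianProduct-* L L (𝟙 ∘ ¬? ∘ (a Fin.≟_)) (𝟙 ∘ ¬? ∘ (b Fin.≟_)) ⟩
      others a * others b                          ≡⟨ cong₂ _*_ (others≡ (proj₁ (∈-cartesianProduct⁻ L L p∈D)))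
                                                                (others≡ (proj₂ (∈-cartesianProduct⁻ L L p∈D))) ⟩
      (k ∸ 1) * (k ∸ 1)                            ∎
      where
      open ≡-Reasoning
      others : F → ℕ
      others x = ∑ L (𝟙 ∘ ¬? ∘ (x Fin.≟_))
      others≡ : ∀ {x} → x ∈ L → others x ≡ k ∸ 1
      others≡ x∈L = cong (_∸ 1) (∑-𝟙-≢ Fin._≟_ L-unique x∈L)

    ∑-alignedPairs : ∑ nonzero (λ ξ → alignedPairs ξ D) ≤ (k * k) * ((k ∸ 1) * (k ∸ 1))
    ∑-alignedPairs = begin
      ∑ nonzero (λ ξ → alignedPairs ξ D)                             ≡⟨ ∑-swap nonzero D _ ⟩
      ∑ D (λ p → ∑ nonzero (λ ξ → ∑ D (𝟙 ∘ aligned? ξ p)))           ≡⟨ ∑-cong D (λ {p} _ → ∑-swap nonzero D (λ ξ → 𝟙 ∘ aligned? ξ p)) ⟩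
      ∑ D (λ p → ∑ D (λ p′ → ∑ nonzero (λ ξ → 𝟙 (aligned? ξ p p′)))) ≤⟨ ∑-mono-≤ D (λ {p} _ → ∑-mono-≤ D (λ {p′} _ → ∑-𝟙-aligned≤𝟙-differ p p′)) ⟩
      ∑ D (λ p → ∑ D (𝟙 ∘ differ? p))                                ≡⟨ ∑-cong D ∑-𝟙-differ ⟩
      ∑ D (λ _ → (k ∸ 1) * (k ∸ 1))                                  ≡⟨ ∑-const D _ ⟩
      length D * ((k ∸ 1) * (k ∸ 1))                                 ≡⟨ cong (_* ((k ∸ 1) * (k ∸ 1))) length-D ⟩
      (k * k) * ((k ∸ 1) * (k ∸ 1))                                  ∎
      where open ≤-Reasoning

    ∃-slope-with-few-alignedPairs : (k ∸ 1) * (k ∸ 1) ≤ n → ∃ λ ξ → ξ ≢ zero × alignedPairs ξ D ≤ k * k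
    ∃-slope-with-few-alignedPairs [k-1]²≤n =
      let ξ , ξ∈ , avg = ∃≤average nonzero (λ ξ → alignedPairs ξ D) (subst (0 <_) (sym length-nonzero) (>-nonZero⁻¹ n))
      in ξ , nonzero⇒≢zero ξ∈ , *-cancelˡ-≤ n (begin
        n * alignedPairs ξ D                 ≡⟨ cong (_* alignedPairs ξ D) length-nonzero ⟨
        length nonzero * alignedPairs ξ D    ≤⟨ avg ⟩
        ∑ nonzero (λ ξ → alignedPairs ξ D)   ≤⟨ ∑-alignedPairs ⟩
        (k * k) * ((k ∸ 1) * (k ∸ 1))        ≤⟨ *-monoʳ-≤ (k * k) [k-1]²≤n ⟩
        (k * k) * n                          ≡⟨ *-comm (k * k) n ⟩
        n * (k * k)                          ∎)
      where
      open ≤-Reasoning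
      nonzero⇒≢zero : ∀ {ξ} → ξ ∈ nonzero → ξ ≢ zero
      nonzero⇒≢zero ξ∈ with ∈-map⁻ suc ξ∈
      ... | _ , _ , refl = λ ()

    ∃-line-collision : suc n < k * k → ∀ ξ →
      ∃ λ p → ∃ λ p′ → p ∈ D × p′ ∈ D × p ≢ p′ × line ξ p ≡ line ξ p′
    ∃-line-collision q<k² ξ = ∃-collision D-unique (begin-strict
      length (image D)     ≤⟨ unique-⊆⇒length-≤ (image-unique D) (λ {z} _ → ∈-allFin z) ⟩
      length (allFin (suc n)) ≡⟨ length-tabulate id ⟩
      suc n                <⟨ q<k² ⟩
      k * k                ≡⟨ length-D ⟨
      length D             ∎)
      where
      open ≤-Reasoning
      open Collisions _≟²_ Fin._≟_ (line ξ)

    module Rescaled (A : Subset (suc n)) (L⊆A : ∀ {a} → a ∈ L → a ∈ₛ A)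
      {ξ a b c d : F} (ξ≢0 : ξ ≢ zero) (ab∈D : (a , b) ∈ D) (cd∈D : (c , d) ∈ D) (b≢d : b ≢ d)
      (e : line ξ (a , b) ≡ line ξ (c , d)) where

      g : F × F → F
      g (a₁ , a₄) = a₁ ⊗ (b ⊖ d) ⊕ a₄ ⊗ (c ⊖ a)

      open Collisions _≟²_ Fin._≟_ g

      collide⇒aligned : ∀ {p p′} → Collide p p′ → Aligned ξ p p′
      collide⇒aligned {a₁ , a₄} {c₁ , c₄} (p≢p′ , g≡) = (a₁≢c₁ , a₄≢c₄) , line≡
        where
        line≡ : a₁ +[ ξ ]· a₄ ≡ c₁ +[ ξ ]· c₄
        line≡ = scaled-+[]· {ξ} {b ⊖ d} {a₁} {a₄} {c₁} {c₄} (⊖-≢-zero b≢d)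
          (subst (λ y → a₁ ⊗ (b ⊖ d) ⊕ a₄ ⊗ y ≡ c₁ ⊗ (b ⊖ d) ⊕ c₄ ⊗ y)
                 (sym (+[]·-slope {ξ} {a} {b} {c} {d} e)) g≡)
        a₁≢c₁ : a₁ ≢ c₁
        a₁≢c₁ refl = p≢p′ (cong (a₁ ,_) (+[]·-cancelʳ {ξ} {a₁} {a₄} {c₄} ξ≢0 line≡))
        a₄≢c₄ : a₄ ≢ c₄
        a₄≢c₄ refl = p≢p′ (cong (_, a₄) (+[]·-cancelˡ {ξ} {a₁} {a₄} {c₁} line≡))

      g∈I : ∀ {a₁ a₄} → a₁ ∈ L → a₄ ∈ L → InI A (g (a₁ , a₄))
      g∈I {a₁} {a₄} a₁∈L a₄∈L = a₁ , b , d , a₄ , c , a , (L⊆A a₁∈L , L⊆A b∈L , L⊆A d∈L , L⊆A a₄∈L , L⊆A c∈L , L⊆A a∈L) , refl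
        where
        a∈L : a ∈ L
        a∈L = proj₁ (∈-cartesianProduct⁻ L L ab∈D)
        b∈L : b ∈ L
        b∈L = proj₂ (∈-cartesianProduct⁻ L L ab∈D)
        c∈L : c ∈ L
        c∈L = proj₁ (∈-cartesianProduct⁻ L L cd∈D)
        d∈L : d ∈ L
        d∈L = proj₂ (∈-cartesianProduct⁻ L L cd∈D)

      image⊆I : ∀ {z} → z ∈ image D → z ∈ₛ I A
      image⊆I z∈ =
        let (a₁ , a₄) , a₁a₄∈D , g≡z = ∈-image⁻ D z∈
        in subst (_∈ₛ I A) g≡z (InI⇒∈I {A} {g (a₁ , a₄)}
             (g∈I (proj₁ (∈-cartesianProduct⁻ L L a₁a₄∈D)) (proj₂ (∈-cartesianProduct⁻ L L a₁a₄∈D))))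

      few-aligned⇒k²≤2∣I∣ : alignedPairs ξ D ≤ k * k → k * k ≤ 2 * ∣ I A ∣
      few-aligned⇒k²≤2∣I∣ few = begin
        k * k                   ≡⟨ length-D ⟨
        length D                ≤⟨ length-≤-2*image D-unique few-collisions ⟩
        2 * length (image D)    ≤⟨ *-monoʳ-≤ 2 (unique-⊆-subset⇒length-≤ (I A) (image-unique D) image⊆I) ⟩
        2 * ∣ I A ∣             ∎
        where
        open ≤-Reasoning
        few-collisions : collisions D ≤ length D
        few-collisions = begin
          collisions D       ≤⟨ ∑-mono-≤ D (λ {p} _ → ∑-mono-≤ D λ {p′} _ → 𝟙-mono (collide? p p′) (aligned? ξ p p′) collide⇒aligned) ⟩
          alignedPairs ξ D   ≤⟨ few ⟩
          k * k              ≡⟨ length-D ⟨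
          length D           ∎

    k²≤2∣I∣ : (A : Subset (suc n)) → (∀ {a} → a ∈ L → a ∈ₛ A) →
      (k ∸ 1) * (k ∸ 1) ≤ n → suc n < k * k → k * k ≤ 2 * ∣ I A ∣
    k²≤2∣I∣ A L⊆A [k-1]²≤n q<k² =
      let ξ , ξ≢0 , few = ∃-slope-with-few-alignedPairs [k-1]²≤n
          (a , b) , (c , d) , ab∈D , cd∈D , ab≢cd , e = ∃-line-collision q<k² ξ
      in Rescaled.few-aligned⇒k²≤2∣I∣ A L⊆A ξ≢0 ab∈D cd∈D (line-collision⇒≢₂ {ξ} ab≢cd e) e few

  square≤2∣I∣ : ∀ (A : Subset (suc n)) {k} L → Unique L → length L ≡ k → (∀ {a} → a ∈ L → a ∈ₛ A) →
    (k ∸ 1) * (k ∸ 1) ≤ n → suc n < k * k → k * k ≤ 2 * ∣ I A ∣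
  square≤2∣I∣ A L L-unique refl L⊆A = k²≤2∣I∣ L L-unique A L⊆A

theorem3 : (q : ℕ) → (pr : Prime q) → (A : Subset q) →
    q < ∣ A ∣ * ∣ A ∣ →
    q ≤ 2 * ∣ ZMod.I q {{prime⇒nonZero pr}} A ∣
theorem3 zero    pr = contradiction pr ¬prime[0]
theorem3 (suc n) pr A q<∣A∣² =
  let k , k≤∣A∣ , q<k² , [k-1]²≤q = ∃-least-square-above (suc n) ∣ A ∣ q<∣A∣²
      L , L-unique , ∣L∣≡k , L⊆A = ∃-unique-list-in-subset A k≤∣A∣
  in ≤-trans (<⇒≤ q<k²) (square≤2∣I∣ A L L-unique ∣L∣≡k L⊆A (≤-pred (square≤prime⇒square<prime (k ∸ 1) pr [k-1]²≤q)) q<k²)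
  where open Slopes n pr
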